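{- Let $g_1 \neq g_2$ be positive integers and $t,s$ non-negative integers. If there exists a $4$-GDD of type $g_1^t g_2^s$, then $t \geq 4$ or $s \geq 4$ or $t = s = 3$.
   Context: A $4$-GDD (group divisible design with block size $4$) consists of a finite set $X$ of points, a partition of $X$ into parts called groups, and a collection of $4$-element subsets of $X$ called blocks, such that no block contains two points of the same group and any two points from distinct groups lie together in exactly one block. The type $g_1^t g_2^s$ means there are exactly $t$ groups of size $g_1$ and $s$ groups of size $g_2$ (and no other groups). -}

module Defs where

open import Data.Nat using (ℕ)
open import Data.Fin using (Fin)
open import Data.Product using (Σ; ∃; _×_; _,_)
open import Data.Sum using (_⊎_; inj₁; inj₂)
open import Relation.Binary.PropositionalEquality using (_≡_; _≢_)

-- Canonical point set of a GDD of type g1^t g2^s: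
-- the i-th group of size g1 is {inj₁ (i , a) | a : Fin g1},
-- the j-th group of size g2 is {inj₂ (j , b) | b : Fin g2}.
-- (Every GDD of that type is isomorphic to one on this point set.)
Point : ℕ → ℕ → ℕ → ℕ → Set
Point g₁ t g₂ s = (Fin t × Fin g₁) ⊎ (Fin s × Fin g₂)

GroupLabel : ℕ → ℕ → Set
GroupLabel t s = Fin t ⊎ Fin s

groupOf : ∀ {g₁ t g₂ s} → Point g₁ t g₂ s → GroupLabel t s
groupOf (inj₁ (i , _)) = inj₁ i
groupOf (inj₂ (j , _)) = inj₂ j

-- A block of size 4 is listed as a map Fin 4 → points; the transversality
-- condition below forces the 4 entries to be distinct, so it is a 4-subset.
Block : ℕ → ℕ → ℕ → ℕ → Set
Block g₁ t g₂ s = Fin 4 → Point g₁ t g₂ s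

_∈B_ : ∀ {g₁ t g₂ s} → Point g₁ t g₂ s → Block g₁ t g₂ s → Set
x ∈B B = ∃ λ a → B a ≡ x

record FourGDD (g₁ t g₂ s : ℕ) : Set where
  field
    numBlocks : ℕ
    block     : Fin numBlocks → Block g₁ t g₂ s
    transversal : ∀ k (a c : Fin 4) → a ≢ c →
                  groupOf (block k a) ≢ groupOf (block k c)
    pairCover : ∀ (x y : Point g₁ t g₂ s) → groupOf x ≢ groupOf y →
                Σ (Fin numBlocks) λ k → (x ∈B block k × y ∈B block k) ×
                  (∀ k′ → x ∈B block k′ → y ∈B block k′ → k′ ≡ k)

{-# OPTIONS --safe #-}
-- A block meets four distinct groups, so there are at least four groups, and only the types
-- g₁²g₂², g₁³g₂¹, g₁¹g₂³ (four groups) and g₁²g₂³, g₁³g₂² (five groups) remain to be excluded.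
-- With four groups every block meets every group, so sending a pair of points from groups L ≠ L′
-- to the block through it is a bijection: the number of blocks is |L| |L′| for every such pair,
-- and a group L of size gᵢ next to groups of both sizes gives gᵢ g₁ = gᵢ g₂.  With five groups a
-- block misses at most one group.  Taking groups A₁, A₂ of size g₁ and B₁, B₂ of size g₂, send
-- each pair in A₁ × A₂ or B₁ × B₂ to a pair in A₁ × B₁ or A₂ × B₂ covered by the same block;
-- this is injective, so g₁² + g₂² ≤ 2 g₁ g₂, i.e. g₁ = g₂.
module Submission where

open import Defs
open import Data.Nat using (ℕ; zero; suc; _+_; _*_; _≤_; _<_; _≥_; z≤n; s≤s; NonZero; >-nonZero)
open import Data.Nat.Properties
  using (≤-refl; ≤-total; ≤-antisym; <⇒≱; +-identityʳ; +-comm; *-comm; +-cancelˡ-≤;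
         *-cancelˡ-≡; n≤0⇒n≡0; m*n≡0⇒m≡0∨n≡0; m≤n⇒∃[o]m+o≡n; module ≤-Reasoning)
open import Data.Nat.Tactic.RingSolver using (solve-∀)
open import Data.Fin using (Fin; punchOut; fromℕ<; _≟_)
open import Data.Fin.Properties using (injective⇒≤; punchOut-injective; any?; +↔⊎; *↔×)
open import Data.Fin.Patterns using (0F; 1F)
open import Data.Product using (_×_; _,_; Σ; ∃; ∃₂; proj₁; proj₂; uncurry)
open import Data.Sum using (_⊎_; inj₁; inj₂; reduce)
open import Data.Sum.Properties using (≡-dec)
open import Data.Sum.Function.Propositional using (_⊎-↔_)
open import Data.Empty using (⊥-elim)
open import Function using (_∘_)
open import Function.Bundles using (_↔_; Inverse; Injection; mk↣)
open import Function.Construct.Composition using (_↣-∘_; _↔-∘_)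
open import Function.Definitions using (Injective)
open import Function.Properties.Inverse using (↔⇒↣; ↔-sym; ↔-refl)
open import Relation.Binary.PropositionalEquality
open import Relation.Nullary using (¬_; Dec; yes; no)
open import Relation.Nullary.Decidable using (decidable-stable)

injective⇒size≤ : ∀ {A B : Set} {m n} → A ↔ Fin m → B ↔ Fin n →
                  {f : A → B} → Injective _≡_ _≡_ f → m ≤ n
injective⇒size≤ A↔m B↔n f-inj =
  injective⇒≤ (Injection.injective (↔⇒↣ B↔n ↣-∘ (mk↣ f-inj ↣-∘ ↔⇒↣ (↔-sym A↔m))))

pairs↔ : ∀ {a b} → (Fin a × Fin b) ↔ Fin (a * b)
pairs↔ = ↔-sym *↔×

twoPairs↔ : ∀ {a b c d} → (Fin a × Fin b ⊎ Fin c × Fin d) ↔ Fin (a * b + c * d)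
twoPairs↔ = ↔-sym +↔⊎ ↔-∘ (pairs↔ ⊎-↔ pairs↔)

injective-missing⇒< : ∀ {m n} {f : Fin m → Fin n} → Injective _≡_ _≡_ f →
                      ∀ {j} → (∀ i → f i ≢ j) → m < n
injective-missing⇒< {n = suc _} f-inj f≢j =
  s≤s (injective⇒≤ {f = λ i → punchOut (f≢j i ∘ sym)}
                   (f-inj ∘ punchOut-injective (f≢j _ ∘ sym) (f≢j _ ∘ sym)))

injective-missing₂⇒< : ∀ {m n} {f : Fin m → Fin n} → Injective _≡_ _≡_ f →
                       ∀ {j j′} → j ≢ j′ → (∀ i → f i ≢ j) → (∀ i → f i ≢ j′) → suc m < n
injective-missing₂⇒< {n = suc _} f-inj j≢j′ f≢j f≢j′ =
  s≤s (injective-missing⇒< {f = λ i → punchOut (f≢j i ∘ sym)}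
         (f-inj ∘ punchOut-injective (f≢j _ ∘ sym) (f≢j _ ∘ sym))
         (λ i → f≢j′ i ∘ punchOut-injective (f≢j i ∘ sym) j≢j′))

square-excess : ∀ a d → a * a + (a + d) * (a + d) ≤ a * (a + d) + a * (a + d) → d ≡ 0
square-excess a d le = reduce (m*n≡0⇒m≡0∨n≡0 d (n≤0⇒n≡0 (+-cancelˡ-≤ twice _ 0 excess≤0)))
  where
  open ≤-Reasoning
  twice : ℕ
  twice = a * (a + d) + a * (a + d)
  expand : ∀ a d → a * (a + d) + a * (a + d) + d * d ≡ a * a + (a + d) * (a + d)
  expand = solve-∀
  excess≤0 : twice + d * d ≤ twice + 0
  excess≤0 = begin
    twice + d * d                 ≡⟨ expand a d ⟩
    a * a + (a + d) * (a + d)     ≤⟨ le ⟩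
    twice                         ≡⟨ +-identityʳ twice ⟨
    twice + 0                     ∎

squares≤twice-product⇒≡-from≤ : ∀ {a b} → a ≤ b → a * a + b * b ≤ a * b + a * b → a ≡ b
squares≤twice-product⇒≡-from≤ {a} a≤b le with m≤n⇒∃[o]m+o≡n a≤b
... | d , refl rewrite square-excess a d le = sym (+-identityʳ a)

squares≤twice-product⇒≡ : ∀ a b → a * a + b * b ≤ a * b + a * b → a ≡ b
squares≤twice-product⇒≡ a b le with ≤-total a b
... | inj₁ a≤b = squares≤twice-product⇒≡-from≤ a≤b le
... | inj₂ b≤a = sym (squares≤twice-product⇒≡-from≤ b≤a
                       (subst₂ _≤_ (+-comm (a * a) (b * b))
                                   (cong₂ _+_ (*-comm a b) (*-comm a b)) le))

distinct-labels : ∀ t s → t + s ≥ 2 → ∃₂ λ (L L′ : GroupLabel t s) → L ≢ L′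
distinct-labels (suc (suc t)) s       _ = inj₁ 0F , inj₁ 1F , λ ()
distinct-labels (suc t)       (suc s) _ = inj₁ 0F , inj₂ 0F , λ ()
distinct-labels zero    (suc (suc s)) _ = inj₂ 0F , inj₂ 1F , λ ()
distinct-labels 1 0 (s≤s ())
distinct-labels 0 1 (s≤s ())

module Groups (g₁ g₂ : ℕ) {t s : ℕ} where

  groupSize : GroupLabel t s → ℕ
  groupSize (inj₁ _) = g₁
  groupSize (inj₂ _) = g₂

  pointOf : (L : GroupLabel t s) → Fin (groupSize L) → Point g₁ t g₂ s
  pointOf (inj₁ i) c = inj₁ (i , c)
  pointOf (inj₂ j) c = inj₂ (j , c)

  groupOf-pointOf : ∀ L c → groupOf (pointOf L c) ≡ L
  groupOf-pointOf (inj₁ _) _ = refl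
  groupOf-pointOf (inj₂ _) _ = refl

  pointOf-injective : ∀ L → Injective _≡_ _≡_ (pointOf L)
  pointOf-injective (inj₁ _) refl = refl
  pointOf-injective (inj₂ _) refl = refl

  coordinate : ∀ L (x : Point g₁ t g₂ s) → groupOf x ≡ L → Fin (groupSize L)
  coordinate _ (inj₁ (_ , c)) refl = c
  coordinate _ (inj₂ (_ , c)) refl = c

  pointOf-coordinate : ∀ L x eq → pointOf L (coordinate L x eq) ≡ x
  pointOf-coordinate _ (inj₁ _) refl = refl
  pointOf-coordinate _ (inj₂ _) refl = refl

  somePoint : g₁ ≥ 1 → g₂ ≥ 1 → ∀ L → Fin (groupSize L)
  somePoint g₁≥1 _ (inj₁ _) = fromℕ< g₁≥1
  somePoint _ g₂≥1 (inj₂ _) = fromℕ< g₂≥1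

  Pairs : GroupLabel t s → GroupLabel t s → Set
  Pairs L L′ = Fin (groupSize L) × Fin (groupSize L′)

module _ {g₁ t g₂ s : ℕ} (D : FourGDD g₁ t g₂ s) where
  open FourGDD D
  open Groups g₁ g₂ {t} {s}

  private
    Label : Set
    Label = GroupLabel t s

  labelOf : Fin numBlocks → Fin 4 → Label
  labelOf k = groupOf ∘ block k

  labelOf-injective : ∀ k → Injective _≡_ _≡_ (labelOf k)
  labelOf-injective k {a} {c} eq = decidable-stable (a ≟ c) (λ a≢c → transversal k a c a≢c eq)

  Meets : Fin numBlocks → Label → Set
  Meets k L = ∃ λ a → labelOf k a ≡ L

  meets? : ∀ k L → Dec (Meets k L)
  meets? k L = any? (λ a → ≡-dec _≟_ _≟_ (labelOf k a) L)

  private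
    index : Label → Fin (t + s)
    index = Inverse.to (↔-sym +↔⊎)

    index-injective : Injective _≡_ _≡_ index
    index-injective = Injection.injective (↔⇒↣ (↔-sym +↔⊎))

    index-labelOf-injective : ∀ k → Injective _≡_ _≡_ (index ∘ labelOf k)
    index-labelOf-injective k = labelOf-injective k ∘ index-injective

    missing⇒index≢ : ∀ {k L} → ¬ Meets k L → ∀ a → index (labelOf k a) ≢ index L
    missing⇒index≢ ¬meets a = ¬meets ∘ (a ,_) ∘ index-injective

  block⇒groups≥4 : Fin numBlocks → t + s ≥ 4
  block⇒groups≥4 k = injective⇒≤ (index-labelOf-injective k)

  meets-every-group : t + s ≤ 4 → ∀ L k → Meets k L
  meets-every-group ≤4 L k = decidable-stable (meets? k L) λ ¬meets →
    <⇒≱ (injective-missing⇒< (index-labelOf-injective k) (missing⇒index≢ ¬meets)) ≤4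

  meets-other : t + s ≤ 5 → ∀ {L L′} → L ≢ L′ → ∀ k → ¬ Meets k L → Meets k L′
  meets-other ≤5 {L} {L′} L≢L′ k ¬meets = decidable-stable (meets? k L′) λ ¬meets′ →
    <⇒≱ (injective-missing₂⇒< (index-labelOf-injective k) (L≢L′ ∘ index-injective)
           (missing⇒index≢ ¬meets) (missing⇒index≢ ¬meets′)) ≤5

  pointIn : ∀ k L → Meets k L → Fin (groupSize L)
  pointIn k L (a , eq) = coordinate L (block k a) eq

  pointIn-∈ : ∀ k L m → pointOf L (pointIn k L m) ∈B block k
  pointIn-∈ k L (a , eq) = a , sym (pointOf-coordinate L (block k a) eq)

  ∈⇒meets : ∀ {k L c} → pointOf L c ∈B block k → Meets k L
  ∈⇒meets {L = L} {c} (a , eq) = a , trans (cong groupOf eq) (groupOf-pointOf L c)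

  meets-group-once : ∀ {k L c c′} → pointOf L c ∈B block k → pointOf L c′ ∈B block k → c ≡ c′
  meets-group-once {k} {L} (a , eq) (a′ , eq′)
    with labelOf-injective k (trans (proj₂ (∈⇒meets (a , eq))) (sym (proj₂ (∈⇒meets (a′ , eq′)))))
  ... | refl = pointOf-injective L (trans (sym eq) eq′)

  Covers : ∀ {L L′} → Pairs L L′ → Fin numBlocks → Set
  Covers {L} {L′} (c , c′) k = pointOf L c ∈B block k × pointOf L′ c′ ∈B block k

  covers-one-pair : ∀ {L L′ k} {p q : Pairs L L′} → Covers p k → Covers q k → p ≡ q
  covers-one-pair (c∈ , c′∈) (d∈ , d′∈) =
    cong₂ _,_ (meets-group-once c∈ d∈) (meets-group-once c′∈ d′∈)

  module _ {L L′ : Label} (L≢L′ : L ≢ L′) where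

    private
      groups-differ : ∀ c c′ → groupOf (pointOf L c) ≢ groupOf (pointOf L′ c′)
      groups-differ c c′ eq =
        L≢L′ (trans (sym (groupOf-pointOf L c)) (trans eq (groupOf-pointOf L′ c′)))

      cover : (p : Pairs L L′) →
              Σ (Fin numBlocks) λ k → Covers p k × (∀ {k′} → Covers p k′ → k′ ≡ k)
      cover (c , c′) with pairCover (pointOf L c) (pointOf L′ c′) (groups-differ c c′)
      ... | k , covers , unique = k , covers , uncurry (unique _)

    blockThrough : Pairs L L′ → Fin numBlocks
    blockThrough p = proj₁ (cover p)

    covers-blockThrough : ∀ p → Covers p (blockThrough p)
    covers-blockThrough p = proj₁ (proj₂ (cover p))

    covered-once : ∀ {p k k′} → Covers p k → Covers p k′ → k ≡ k′
    covered-once {p} covers covers′ =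
      trans (proj₂ (proj₂ (cover p)) covers) (sym (proj₂ (proj₂ (cover p)) covers′))

    blockThrough-injective : Injective _≡_ _≡_ blockThrough
    blockThrough-injective {p} {q} eq =
      covers-one-pair (covers-blockThrough p) (subst (Covers q) (sym eq) (covers-blockThrough q))

    pairs≤blocks : groupSize L * groupSize L′ ≤ numBlocks
    pairs≤blocks = injective⇒size≤ pairs↔ ↔-refl blockThrough-injective

  module _ {M M′ : Label} (M≢M′ : M ≢ M′)
           (meets-M : ∀ k → Meets k M) (meets-M′ : ∀ k → Meets k M′) where

    private
      pairIn : Fin numBlocks → Pairs M M′
      pairIn k = pointIn k M (meets-M k) , pointIn k M′ (meets-M′ k)

      covers-pairIn : ∀ k → Covers (pairIn k) k
      covers-pairIn k = pointIn-∈ k M (meets-M k) , pointIn-∈ k M′ (meets-M′ k)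

      pairIn-injective : Injective _≡_ _≡_ pairIn
      pairIn-injective {k} {k′} eq =
        covered-once M≢M′ (covers-pairIn k) (subst (λ p → Covers p k′) (sym eq) (covers-pairIn k′))

    blocks≤pairs : numBlocks ≤ groupSize M * groupSize M′
    blocks≤pairs = injective⇒size≤ ↔-refl pairs↔ pairIn-injective

  groups≥4 : g₁ ≥ 1 → g₂ ≥ 1 → t + s ≥ 2 → t + s ≥ 4
  groups≥4 g₁≥1 g₂≥1 t+s≥2 with distinct-labels t s t+s≥2
  ... | L , L′ , L≢L′ =
    block⇒groups≥4 (blockThrough L≢L′ (somePoint g₁≥1 g₂≥1 L , somePoint g₁≥1 g₂≥1 L′))

  blocks≡pairs : t + s ≤ 4 → ∀ {L L′} → L ≢ L′ → numBlocks ≡ groupSize L * groupSize L′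
  blocks≡pairs ≤4 {L} {L′} L≢L′ =
    ≤-antisym (blocks≤pairs L≢L′ (meets-every-group ≤4 L) (meets-every-group ≤4 L′))
              (pairs≤blocks L≢L′)

  sizes-≡ : t + s ≤ 4 → ∀ L M M′ → L ≢ M → L ≢ M′ → .{{NonZero (groupSize L)}} →
            groupSize M ≡ groupSize M′
  sizes-≡ ≤4 L M M′ L≢M L≢M′ =
    *-cancelˡ-≡ _ _ (groupSize L) (trans (sym (blocks≡pairs ≤4 L≢M)) (blocks≡pairs ≤4 L≢M′))

  module _ (≤5 : t + s ≤ 5) (A₁ A₂ B₁ B₂ : Label)
           (A₁≢A₂ : A₁ ≢ A₂) (B₁≢B₂ : B₁ ≢ B₂) (A₁≢B₁ : A₁ ≢ B₁) (A₂≢B₂ : A₂ ≢ B₂) where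

    private
      Inner : Set
      Inner = Pairs A₁ A₂ ⊎ Pairs B₁ B₂

      Crossed : Set
      Crossed = Pairs A₁ B₁ ⊎ Pairs A₂ B₂

      blockOf : Inner → Fin numBlocks
      blockOf (inj₁ p) = blockThrough A₁≢A₂ p
      blockOf (inj₂ q) = blockThrough B₁≢B₂ q

      CoversCrossed : Crossed → Fin numBlocks → Set
      CoversCrossed (inj₁ p) = Covers p
      CoversCrossed (inj₂ p) = Covers p

      crossed-covered-once : ∀ {o k k′} → CoversCrossed o k → CoversCrossed o k′ → k ≡ k′
      crossed-covered-once {inj₁ _} = covered-once A₁≢B₁
      crossed-covered-once {inj₂ _} = covered-once A₂≢B₂

      -- Pairs in A₁ × A₂ prefer B₁ and pairs in B₁ × B₂ prefer A₂, so the two inner pairs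
      -- of a block meeting all four groups are sent to different sides of Crossed.
      crossA : (p : Pairs A₁ A₂) → Dec (Meets (blockOf (inj₁ p)) B₁) → Crossed
      crossA (x , _) (yes m) = inj₁ (x , pointIn _ B₁ m)
      crossA (_ , y) (no ¬m) = inj₂ (y , pointIn _ B₂ (meets-other ≤5 B₁≢B₂ _ ¬m))

      crossB : (q : Pairs B₁ B₂) → Dec (Meets (blockOf (inj₂ q)) A₂) → Crossed
      crossB (_ , v) (yes m) = inj₂ (pointIn _ A₂ m , v)
      crossB (u , _) (no ¬m) = inj₁ (pointIn _ A₁ (meets-other ≤5 (A₁≢A₂ ∘ sym) _ ¬m) , u)

      cross : Inner → Crossed
      cross (inj₁ p) = crossA p (meets? _ B₁)
      cross (inj₂ q) = crossB q (meets? _ A₂)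

      covers-crossA : ∀ p d → CoversCrossed (crossA p d) (blockOf (inj₁ p))
      covers-crossA p (yes m) = proj₁ (covers-blockThrough A₁≢A₂ p) , pointIn-∈ _ B₁ m
      covers-crossA p (no _)  = proj₂ (covers-blockThrough A₁≢A₂ p) , pointIn-∈ _ B₂ _

      covers-crossB : ∀ q d → CoversCrossed (crossB q d) (blockOf (inj₂ q))
      covers-crossB q (yes m) = pointIn-∈ _ A₂ m , proj₂ (covers-blockThrough B₁≢B₂ q)
      covers-crossB q (no _)  = pointIn-∈ _ A₁ _ , proj₁ (covers-blockThrough B₁≢B₂ q)

      covers-cross : ∀ i → CoversCrossed (cross i) (blockOf i)
      covers-cross (inj₁ p) = covers-crossA p (meets? _ B₁)
      covers-cross (inj₂ q) = covers-crossB q (meets? _ A₂)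

      crossA≢crossB : ∀ p q → blockOf (inj₁ p) ≡ blockOf (inj₂ q) →
                      ∀ d d′ → crossA p d ≢ crossB q d′
      crossA≢crossB p q same (yes _)  (no ¬m) _ =
        ¬m (∈⇒meets (subst (λ k → _ ∈B block k) same (proj₂ (covers-blockThrough A₁≢A₂ p))))
      crossA≢crossB p q same (no ¬m) (yes _)  _ =
        ¬m (∈⇒meets (subst (λ k → _ ∈B block k) (sym same) (proj₁ (covers-blockThrough B₁≢B₂ q))))

      same-block⇒≡ : ∀ i j → blockOf i ≡ blockOf j → cross i ≡ cross j → i ≡ j
      same-block⇒≡ (inj₁ p) (inj₁ p′) same _ = cong inj₁ (blockThrough-injective A₁≢A₂ same)
      same-block⇒≡ (inj₂ q) (inj₂ q′) same _ = cong inj₂ (blockThrough-injective B₁≢B₂ same)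
      same-block⇒≡ (inj₁ p) (inj₂ q)  same e = ⊥-elim (crossA≢crossB p q same _ _ e)
      same-block⇒≡ (inj₂ q) (inj₁ p)  same e = ⊥-elim (crossA≢crossB p q (sym same) _ _ (sym e))

      cross-injective : Injective _≡_ _≡_ cross
      cross-injective {i} {j} e = same-block⇒≡ i j (crossed-covered-once {cross j}
        (subst (λ o → CoversCrossed o (blockOf i)) e (covers-cross i)) (covers-cross j)) e

    crossed-products-≤ : groupSize A₁ * groupSize A₂ + groupSize B₁ * groupSize B₂ ≤
                         groupSize A₁ * groupSize B₁ + groupSize A₂ * groupSize B₂
    crossed-products-≤ = injective⇒size≤ twoPairs↔ twoPairs↔ cross-injective

mainTheorem3 : (g₁ g₂ t s : ℕ) → g₁ ≥ 1 → g₂ ≥ 1 → g₁ ≢ g₂ →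
               t + s ≥ 2 → FourGDD g₁ t g₂ s →
               (t ≥ 4) ⊎ (s ≥ 4) ⊎ (t ≡ 3 × s ≡ 3)
mainTheorem3 g₁ g₂ t s g₁≥1 g₂≥1 g₁≢g₂ t+s≥2 D = classify t s D (groups≥4 D g₁≥1 g₂≥1 t+s≥2)
  where
  instance
    g₁-nonZero : NonZero g₁
    g₁-nonZero = >-nonZero g₁≥1
    g₂-nonZero : NonZero g₂
    g₂-nonZero = >-nonZero g₂≥1

  pair-and-single : ∀ {t s} → FourGDD g₁ (2 + t) g₂ (1 + s) → 2 + t + (1 + s) ≤ 4 → g₁ ≡ g₂
  pair-and-single D ≤4 = sizes-≡ D ≤4 (inj₁ 0F) (inj₁ 1F) (inj₂ 0F) (λ ()) (λ ())

  two-pairs : ∀ {t s} → FourGDD g₁ (2 + t) g₂ (2 + s) → 2 + t + (2 + s) ≤ 5 → g₁ ≡ g₂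
  two-pairs D ≤5 = squares≤twice-product⇒≡ g₁ g₂
    (crossed-products-≤ D ≤5 (inj₁ 0F) (inj₁ 1F) (inj₂ 0F) (inj₂ 1F) (λ ()) (λ ()) (λ ()) (λ ()))

  classify : ∀ t s → FourGDD g₁ t g₂ s → t + s ≥ 4 → (t ≥ 4) ⊎ (s ≥ 4) ⊎ (t ≡ 3 × s ≡ 3)
  classify zero s _ 4≤s = inj₂ (inj₁ 4≤s)
  classify t zero _ 4≤t+0 = inj₁ (subst (4 ≤_) (+-identityʳ t) 4≤t+0)
  classify (suc (suc (suc (suc t)))) s _ _ = inj₁ (s≤s (s≤s (s≤s (s≤s z≤n))))
  classify t (suc (suc (suc (suc s)))) _ _ = inj₂ (inj₁ (s≤s (s≤s (s≤s (s≤s z≤n)))))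
  classify 3 3 _ _ = inj₂ (inj₂ (refl , refl))
  classify 2 2 D _ = ⊥-elim (g₁≢g₂ (pair-and-single D ≤-refl))
  classify 3 1 D _ = ⊥-elim (g₁≢g₂ (pair-and-single D ≤-refl))
  classify 1 3 D _ = ⊥-elim (g₁≢g₂ (sizes-≡ D ≤-refl (inj₂ 0F) (inj₁ 0F) (inj₂ 1F) (λ ()) (λ ())))
  classify 2 3 D _ = ⊥-elim (g₁≢g₂ (two-pairs D ≤-refl))
  classify 3 2 D _ = ⊥-elim (g₁≢g₂ (two-pairs D ≤-refl))
  classify 1 1 _ (s≤s (s≤s ()))
  classify 1 2 _ (s≤s (s≤s (s≤s ())))
  classify 2 1 _ (s≤s (s≤s (s≤s ())))
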